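{- Let $S$ be a principal opetopic cardinal (a positive opetope). Then its associated positive-to-one poset admits a greatest element $\omega$ for the order $\le$.
   Context: A positive hypergraph $S$ consists of finite sets $S_k$ ($k\in\mathbb{N}$), all but finitely many empty, and maps $\gamma:S_{k+1}\to S_k$, $\delta:S_{k+1}\to\mathcal{P}(S_k)$ with $\delta(a)\neq\emptyset$ for all $a$ and $\delta(a)$ a singleton for $a\in S_1$; $\dim S=\max\{k:S_k\ne\emptyset\}$. For $a\in S_{k+2}$: $\gamma\gamma(a)=\{\gamma(\gamma(a))\}$, $\gamma\delta(a)=\{\gamma(x):x\in\delta(a)\}$, $\delta\gamma(a)=\delta(\gamma(a))$, $\delta\delta(a)=\bigcup_{x\in\delta(a)}\delta(x)$. For $a,b\in S_k$: $a\triangleleft^+b$ iff there is $\alpha\in S_{k+1}$ with $a\in\delta(\alpha)$, $\gamma(\alpha)=b$, and $<^+$ is its transitive closure; for $k\ge1$, $a\triangleleft^-b$ iff $\gamma(a)\in\delta(b)$, and $<^-$ is its transitive closure. An opetopic cardinal is a positive hypergraph satisfying: globularity (for $a\in S_{\ge2}$, $\gamma\gamma(a)=\gamma\delta(a)\setminus\delta\delta(a)$ and $\delta\gamma(a)=\delta\delta(a)\setminus\gamma\delta(a)$); strictness (each $<^+$ on $S_k$ is a strict partial order, and $<^+$ on $S_0$ is total); disjointness (for $k>0$, no $a,b\in S_k$ are comparable both for $<^+$ and for $<^-$); pencil linearity (for $k>0$, $x\in S_{k-1}$, the sets $\{a\in S_k:x\in\delta(a)\}$ and $\{a\in S_k:\gamma(a)=x\}$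 are linearly ordered by $<^+$). $S$ is principal if for every $0\le k\le\dim S$ the set $S_k\setminus\bigcup_{a\in S_{k+1}}\delta(a)$ has exactly one element. The associated positive-to-one poset has elements $\bigsqcup_kS_k$, $\dim x=k$ for $x\in S_k$, $y\prec^-x$ iff $y\in\delta(x)$, $y\prec^+x$ iff $y=\gamma(x)$; $\le$ is the reflexive-transitive closure of $\prec=\prec^-\cup\prec^+$. -}

module Defs where

open import Data.Nat using (ℕ; zero; suc; _<_; _≤_)
open import Data.Fin using (Fin)
open import Data.Fin.Subset using (Subset; _∈_; _∉_)
open import Data.Product using (Σ; ∃; _×_; _,_)
open import Data.Sum using (_⊎_)
open import Relation.Nullary using (¬_)
open import Relation.Binary.PropositionalEquality using (_≡_; _≢_)
open import Relation.Binary.Construct.Closure.Transitive using (TransClosure)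
open import Relation.Binary.Construct.Closure.ReflexiveTransitive using (Star)
open import Function.Bundles using (_⇔_)

-- A positive hypergraph. S_k is represented by Fin (card k); subsets of S_k by Subset (card k).
record PosHypergraph : Set where
  field
    card : ℕ → ℕ
    finite : ∃ λ N → ∀ k → N < k → card k ≡ 0
    γ : ∀ k → Fin (card (suc k)) → Fin (card k)
    δ : ∀ k → Fin (card (suc k)) → Subset (card k)
    δ-nonempty : ∀ k (a : Fin (card (suc k))) → ∃ λ x → x ∈ δ k a
    δ-singleton₁ : ∀ (a : Fin (card 1)) → ∃ λ x → ∀ y → (y ∈ δ 0 a) ⇔ (y ≡ x)

module _ (S : PosHypergraph) where
  open PosHypergraph S

  _∈γδ_ : ∀ {k} → Fin (card k) → Fin (card (suc (suc k))) → Set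
  _∈γδ_ {k} x a = ∃ λ y → y ∈ δ (suc k) a × γ k y ≡ x

  _∈δδ_ : ∀ {k} → Fin (card k) → Fin (card (suc (suc k))) → Set
  _∈δδ_ {k} x a = ∃ λ y → y ∈ δ (suc k) a × x ∈ δ k y

  _◁⁺_ : ∀ {k} → Fin (card k) → Fin (card k) → Set
  _◁⁺_ {k} a b = ∃ λ (α : Fin (card (suc k))) → a ∈ δ k α × γ k α ≡ b

  _<⁺_ : ∀ {k} → Fin (card k) → Fin (card k) → Set
  _<⁺_ {k} = TransClosure (_◁⁺_ {k})

  _◁⁻_ : ∀ {k} → Fin (card (suc k)) → Fin (card (suc k)) → Set
  _◁⁻_ {k} a b = γ k a ∈ δ k b

  _<⁻_ : ∀ {k} → Fin (card (suc k)) → Fin (card (suc k)) → Set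
  _<⁻_ {k} = TransClosure (_◁⁻_ {k})

  record IsOpetopicCardinal : Set where
    field
      glob-γ : ∀ k (a : Fin (card (suc (suc k)))) (x : Fin (card k)) →
        (x ≡ γ k (γ (suc k) a)) ⇔ (x ∈γδ a × ¬ (x ∈δδ a))
      glob-δ : ∀ k (a : Fin (card (suc (suc k)))) (x : Fin (card k)) →
        (x ∈ δ k (γ (suc k) a)) ⇔ (x ∈δδ a × ¬ (x ∈γδ a))
      strict-irrefl : ∀ k (a : Fin (card k)) → ¬ (a <⁺ a)
      strict-total₀ : ∀ (a b : Fin (card 0)) → a ≡ b ⊎ a <⁺ b ⊎ b <⁺ a
      disjoint : ∀ k (a b : Fin (card (suc k))) →
        ¬ ((a <⁺ b ⊎ b <⁺ a) × (a <⁻ b ⊎ b <⁻ a))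
      pencil-δ : ∀ k (x : Fin (card k)) (a b : Fin (card (suc k))) →
        x ∈ δ k a → x ∈ δ k b → a ≡ b ⊎ a <⁺ b ⊎ b <⁺ a
      pencil-γ : ∀ k (x : Fin (card k)) (a b : Fin (card (suc k))) →
        γ k a ≡ x → γ k b ≡ x → a ≡ b ⊎ a <⁺ b ⊎ b <⁺ a

  IsDim : ℕ → Set
  IsDim d = (card d ≢ 0) × (∀ k → d < k → card k ≡ 0)

  NotSource : ∀ k → Fin (card k) → Set
  NotSource k x = ∀ (a : Fin (card (suc k))) → x ∉ δ k a

  IsPrincipal : Set
  IsPrincipal = ∃ λ d → IsDim d ×
    (∀ k → k ≤ d → ∃ λ x → NotSource k x × (∀ y → NotSource k y → y ≡ x))

  -- the associated positive-to-one poset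
  Elem : Set
  Elem = Σ ℕ (λ k → Fin (card k))

  data _≺_ : Elem → Elem → Set where
    ≺⁻ : ∀ {k} {y : Fin (card k)} {x : Fin (card (suc k))} → y ∈ δ k x → (k , y) ≺ (suc k , x)
    ≺⁺ : ∀ {k} {y : Fin (card k)} {x : Fin (card (suc k))} → y ≡ γ k x → (k , y) ≺ (suc k , x)

  _≤ₚ_ : Elem → Elem → Set
  _≤ₚ_ = Star _≺_

{-# OPTIONS --safe #-}
-- The greatest element ω is the unique non-source of the top dimension d. An element y of
-- dimension k < d is below some element of dimension k + 1: either y is a source of some a,
-- or y is the unique non-source of S_k. In the latter case y is a target, because following
-- ◁⁺ upwards from any target must stop (<⁺ is a strict order on a finite set) at a target
-- which is no source, i.e. at y. Climbing one dimension at a time gives y ≤ ω.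
module Submission where

open import Defs
open import Data.Empty using (⊥-elim)
open import Data.Fin using (Fin; fromℕ<)
open import Data.Fin.Induction using (spo-noetherian)
open import Data.Fin.Properties using (¬Fin0; any?)
open import Data.Fin.Subset using (_∈_)
open import Data.Fin.Subset.Properties using (_∈?_)
open import Data.Nat using (ℕ; suc; _≤_; _<_; _≤‴_; ≤‴-refl; ≤‴-step)
open import Data.Nat.Properties using (≤-refl; n<1+n; n≢0⇒n>0; ≮⇒≥; ≤⇒≤‴; ≤‴⇒≤)
open import Data.Product using (∃; _×_; _,_; proj₁; proj₂)
open import Function using (flip)
open import Induction.WellFounded using (Acc; acc)
open import Relation.Binary.Construct.Closure.ReflexiveTransitive using (ε; _◅_)
open import Relation.Binary.Construct.Closure.Transitive using ([_]; _++_)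
open import Relation.Binary.PropositionalEquality using (_≡_; refl; sym; trans; subst; resp₂; isEquivalence)
open import Relation.Binary.Structures using (IsStrictPartialOrder)
open import Relation.Nullary using (¬_; Dec; yes; no)

module _ (S : PosHypergraph) where
  open PosHypergraph S

  <⁺-Irreflexive : ℕ → Set
  <⁺-Irreflexive k = ∀ (a : Fin (card k)) → ¬ _<⁺_ S a a

  <⁺-isStrictPartialOrder : ∀ {k} → <⁺-Irreflexive k → IsStrictPartialOrder _≡_ (_<⁺_ S {k})
  <⁺-isStrictPartialOrder irrefl = record
    { isEquivalence = isEquivalence
    ; irrefl        = λ { refl → irrefl _ }
    ; trans         = _++_
    ; <-resp-≈      = resp₂ _
    }

  source? : ∀ k (y : Fin (card k)) → Dec (∃ λ a → y ∈ δ k a)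
  source? k y = any? λ a → y ∈? δ k a

  nonSource-target : ∀ {k} → <⁺-Irreflexive k → Fin (card (suc k)) →
    ∃ λ b → NotSource S k (γ k b)
  nonSource-target {k} irrefl a₀ =
    ascend a₀ (spo-noetherian (<⁺-isStrictPartialOrder irrefl) (γ k a₀))
    where
    ascend : ∀ a → Acc (flip (_<⁺_ S)) (γ k a) → ∃ λ b → NotSource S k (γ k b)
    ascend a (acc rs) with source? k (γ k a)
    ... | no ¬source      = a , λ b γa∈δb → ¬source (b , γa∈δb)
    ... | yes (b , γa∈δb) = ascend b (rs [ b , γa∈δb , refl ])

  upperCover : ∀ {k} → <⁺-Irreflexive k → (x : Fin (card k)) →
    (∀ y → NotSource S k y → y ≡ x) → Fin (card (suc k)) →
    ∀ y → ∃ λ a → _≺_ S (k , y) (suc k , a)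
  upperCover {k} irrefl x unique a₀ y with source? k y
  ... | yes (a , y∈δa) = a , ≺⁻ y∈δa
  ... | no ¬source with nonSource-target irrefl a₀
  ...   | b , γb-nonSource =
    b , ≺⁺ (trans (unique y λ a y∈δa → ¬source (a , y∈δa)) (sym (unique (γ k b) γb-nonSource)))

module _ (S : PosHypergraph) (oc : IsOpetopicCardinal S) {d : ℕ} (dim : IsDim S d)
  (principal : ∀ k → k ≤ d → ∃ λ x → NotSource S k x × (∀ y → NotSource S k y → y ≡ x))
  where
  open PosHypergraph S
  open IsOpetopicCardinal oc using (strict-irrefl)

  nonSource : ∀ {k} → k ≤ d → Fin (card k)
  nonSource k≤d = proj₁ (principal _ k≤d)

  nonSource-unique : ∀ {k} (k≤d : k ≤ d) y → NotSource S k y → y ≡ nonSource k≤d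
  nonSource-unique k≤d = proj₂ (proj₂ (principal _ k≤d))

  top : Elem S
  top = d , nonSource ≤-refl

  empty-above : ∀ {k} → d < k → ¬ Fin (card k)
  empty-above {k} d<k a = ¬Fin0 (subst Fin (proj₂ dim k d<k) a)

  dim-bound : ∀ {k} → Fin (card k) → k ≤ d
  dim-bound y = ≮⇒≥ λ d<k → empty-above d<k y

  inhabited : ∀ {k} → k ≤‴ d → Fin (card k)
  inhabited ≤‴-refl         = fromℕ< (n≢0⇒n>0 (proj₁ dim))
  inhabited (≤‴-step k<‴d) = γ _ (inhabited k<‴d)

  below-top : ∀ {k} → k ≤‴ d → ∀ y → _≤ₚ_ S (k , y) top
  below-top ≤‴-refl y with nonSource-unique ≤-refl y (λ a → ⊥-elim (empty-above (n<1+n d) a))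
  ... | refl = ε
  below-top {k} (≤‴-step k<‴d) y = proj₂ cover ◅ below-top k<‴d (proj₁ cover)
    where
    k≤d = ≤‴⇒≤ (≤‴-step k<‴d)
    cover = upperCover S (strict-irrefl k) (nonSource k≤d) (nonSource-unique k≤d) (inhabited k<‴d) y

  top-greatest : ∀ x → _≤ₚ_ S x top
  top-greatest (k , y) = below-top (≤⇒≤‴ (dim-bound y)) y

mainTheorem14 : (S : PosHypergraph) → IsOpetopicCardinal S → IsPrincipal S →
    ∃ λ (ω : Elem S) → ∀ (x : Elem S) → _≤ₚ_ S x ω
mainTheorem14 S oc (d , dim , principal) = top S oc dim principal , top-greatest S oc dim principal
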